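{- Let $T$ be a Cayley tree labelled with $[n]_0$ whose only record is $n$. Then $T$ is planted (the root $0$ has degree one), $T$ contains the edge $\{0,n\}$, and the remaining $n-1$ edges of $T$ are exactly the pairs $\{i,x_i\}$, $i=1,\dots,n-1$, given by the columns of the record code $\mathrm{blob}(T)=x_1\cdots x_{n-1}$.
   Context: A Cayley tree labelled with $[n]_0=\{0,\dots,n\}$ is a tree on vertex set $[n]_0$ rooted at $0$, with parent map $f_T$. A non-root vertex $k$ is a record if $k$ is the largest label on the path from $k$ to the root; let $r_1<\dots<r_m$ be the records. The record code $\mathrm{blob}(T)$ is the two-row array with first row $1,\dots,n-1$ and second row $x_1\cdots x_{n-1}$, where $x_i=f_T(i)$ if $i$ is not a record and $x_{r_j}=f_T(r_{j+1})$ for $j=1,\dots,m-1$; its columns are the pairs $(i,x_i)$. -}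

module Defs where

open import Data.Nat using (ℕ; zero; suc; _≤_; _<_; _≤?_; _<?_)
open import Data.Fin using (Fin; toℕ; fromℕ) renaming (zero to fzero; suc to fsuc)
open import Data.Fin.Properties using (all?) renaming (_≟_ to _≟ᶠ_)
open import Data.List using (List; []; _∷_; map; filter; length)
open import Data.List.Base using (allFin)
open import Data.Maybe using (Maybe; just; nothing)
open import Data.Product using (_×_; _,_; ∃; proj₁; proj₂)
open import Data.Bool using (if_then_else_)
open import Function using (_∘_)
open import Relation.Nullary using (Dec; yes; no; ¬_; _×-dec_; ¬?; does; _⊎-dec_)
open import Relation.Binary.PropositionalEquality using (_≡_)

iter : {A : Set} → (A → A) → ℕ → A → A
iter f zero    x = x
iter f (suc k) x = f (iter f k x)

-- A Cayley tree on vertex set [n]₀ = Fin (suc n), rooted at 0, given by its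
-- parent map f_T.  For convenience the parent map is total with parent 0 = 0
-- (the root has no parent; this value carries no information).
record CayleyTree (n : ℕ) : Set where
  field
    parent      : Fin (suc n) → Fin (suc n)
    parent-root : parent fzero ≡ fzero
    reachesRoot : ∀ v → ∃ λ k → iter parent k v ≡ fzero

open CayleyTree public

module _ {n : ℕ} (T : CayleyTree n) where

  -- the vertices on the path from k to the root are the iterates
  -- parent^j k for j = 0..n (a path in a tree on n+1 vertices has ≤ n edges,
  -- and iterates stay at 0 once the root is reached)
  -- k is a record iff k ≠ 0 and k is the largest label on that path
  IsRecord : Fin (suc n) → Set
  IsRecord k = (¬ k ≡ fzero) × (∀ (j : Fin (suc n)) → toℕ (iter (parent T) (toℕ j) k) ≤ toℕ k)

  isRecord? : ∀ k → Dec (IsRecord k)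
  isRecord? k = ¬? (_≟ᶠ_ k fzero) ×-dec all? (λ j → toℕ (iter (parent T) (toℕ j) k) ≤? toℕ k)

  nextRecord : Fin (suc n) → Maybe (Fin (suc n))
  nextRecord i with filter (λ r → isRecord? r ×-dec (toℕ i <? toℕ r)) (allFin (suc n))
  ... | []    = nothing
  ... | r ∷ _ = just r

  -- the second row x_i of the record code blob(T), for 1 ≤ i ≤ n-1:
  -- x_i = f_T(i) if i is not a record, x_{r_j} = f_T(r_{j+1}) for records r_j
  -- (for i = r_m or outside 1..n-1 the value is irrelevant)
  blob : Fin (suc n) → Fin (suc n)
  blob i with isRecord? i | nextRecord i
  ... | no _  | _        = parent T i
  ... | yes _ | just r   = parent T r
  ... | yes _ | nothing  = fzero

  nonRoot : List (Fin (suc n))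
  nonRoot = map fsuc (allFin n)

  columns : List (Fin (suc n))
  columns = filter (λ i → (1 ≤? toℕ i) ×-dec (toℕ i <? n)) (allFin (suc n))

-- unordered edge {a,b}, normalised as (min, max)
edge : {n : ℕ} → Fin n → Fin n → Fin n × Fin n
edge a b = if does (toℕ a ≤? toℕ b) then (a , b) else (b , a)

module _ {n : ℕ} (T : CayleyTree n) where

  treeEdges : List (Fin (suc n) × Fin (suc n))
  treeEdges = map (λ k → edge k (parent T k)) (nonRoot T)

  blobEdges : List (Fin (suc n) × Fin (suc n))
  blobEdges = map (λ i → edge i (blob T i)) (columns T)

  degree : Fin (suc n) → ℕ
  degree v = length (filter (λ e → (_≟ᶠ_ (proj₁ e) v) ⊎-dec (_≟ᶠ_ (proj₂ e) v)) treeEdges)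

-- A child of the root is always a record, since its path to the root is just itself.
-- As the path from n ends in a child of the root, that child is the unique record n,
-- so f_T(n) = 0 and no other vertex is a child of the root.  The vertices
-- 1, …, n-1 are non-records, so their record-code columns are exactly
-- their tree edges {i, f_T(i)}, and T has one further edge {0, n}.
module Submission where

open import Defs
open import Data.Nat using (ℕ; zero; suc; _≤_; _<_; z≤n; s≤s; _≤?_; _<?_)
open import Data.Nat.Properties using (≤-refl; <-irrefl)
open import Data.Bool using (true; false)
open import Data.Fin using (Fin; fromℕ; toℕ; inject₁) renaming (zero to fzero; suc to fsuc)
open import Data.Fin.Properties using (toℕ-fromℕ; toℕ-inject₁; toℕ<n; fromℕ≢inject₁) renaming (_≟_ to _≟ᶠ_)
open import Data.Product using (_×_; _,_; proj₁; proj₂; ∃)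
open import Data.Sum using (_⊎_; inj₁; inj₂) renaming ([_,_] to either)
open import Data.Empty using (⊥-elim)
open import Data.List using (List; []; _∷_; _++_; _∷ʳ_; [_]; map; filter; length; tabulate)
open import Data.List.Properties using (++-identityʳ; map-++; map-tabulate; tabulate-cong; filter-all; filter-none; filter-++)
open import Data.List.Relation.Unary.All using ([]; _∷_)
open import Data.List.Relation.Unary.All.Properties using (tabulate⁺)
open import Data.List.Relation.Unary.Any using (here)
open import Data.List.Membership.Propositional using (_∈_)
open import Data.List.Membership.Propositional.Properties using (∈-++⁺ʳ)
open import Data.List.Relation.Binary.Permutation.Propositional using (_↭_; ↭-sym)
open import Data.List.Relation.Binary.Permutation.Propositional.Properties using (∷↭∷ʳ)
open import Function using (_∘_)
open import Function.Bundles using (_⇔_; Equivalence)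
open import Relation.Nullary using (¬_; Dec; yes; no; does; _×-dec_; _⊎-dec_)
open import Relation.Binary.Definitions using (DecidableEquality)
open import Relation.Binary.PropositionalEquality using (_≡_; _≢_; refl; sym; trans; cong; cong₂; subst; module ≡-Reasoning)

tabulate-∷ʳ : ∀ {A : Set} n (f : Fin (suc n) → A) →
              tabulate f ≡ tabulate (f ∘ inject₁) ∷ʳ f (fromℕ n)
tabulate-∷ʳ zero    f = refl
tabulate-∷ʳ (suc n) f = cong (f fzero ∷_) (tabulate-∷ʳ n (f ∘ fsuc))

iter-reaches⇒∃-preimage : ∀ {A : Set} → DecidableEquality A → (f : A → A) {z v : A} →
                          v ≢ z → ∀ j → iter f j v ≡ z → ∃ λ w → w ≢ z × f w ≡ z
iter-reaches⇒∃-preimage _≟_ f         v≢z zero    v≡z = ⊥-elim (v≢z v≡z)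
iter-reaches⇒∃-preimage _≟_ f {z} {v} v≢z (suc j) fw≡z with iter f j v ≟ z
... | yes w≡z = iter-reaches⇒∃-preimage _≟_ f v≢z j w≡z
... | no  w≢z = iter f j v , w≢z , fw≡z

edge-avoids : ∀ {n} {v a b : Fin n} → a ≢ v → b ≢ v →
              ¬ (proj₁ (edge a b) ≡ v ⊎ proj₂ (edge a b) ≡ v)
edge-avoids {a = a} {b} a≢v b≢v with does (toℕ a ≤? toℕ b)
... | true  = either a≢v b≢v
... | false = either b≢v a≢v

module _ {n : ℕ} (T : CayleyTree n) where

  iter-from-childOfRoot : ∀ {k} → parent T k ≡ fzero →
                          ∀ j → iter (parent T) j k ≡ k ⊎ iter (parent T) j k ≡ fzero
  iter-from-childOfRoot pk≡0 zero = inj₁ refl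
  iter-from-childOfRoot pk≡0 (suc j) with iter-from-childOfRoot pk≡0 j
  ... | inj₁ v≡k = inj₂ (trans (cong (parent T) v≡k) pk≡0)
  ... | inj₂ v≡0 = inj₂ (trans (cong (parent T) v≡0) (parent-root T))

  childOfRoot⇒IsRecord : ∀ {k} → k ≢ fzero → parent T k ≡ fzero → IsRecord T k
  childOfRoot⇒IsRecord {k} k≢0 pk≡0 = k≢0 , λ j → bounded (iter-from-childOfRoot pk≡0 (toℕ j))
    where
    bounded : ∀ {v} → v ≡ k ⊎ v ≡ fzero → toℕ v ≤ toℕ k
    bounded (inj₁ refl) = ≤-refl
    bounded (inj₂ refl) = z≤n

  ∃-childOfRoot-record : ∀ {v} → v ≢ fzero → ∃ λ w → IsRecord T w × parent T w ≡ fzero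
  ∃-childOfRoot-record {v} v≢0 with reachesRoot T v
  ... | j , reaches with iter-reaches⇒∃-preimage _≟ᶠ_ (parent T) v≢0 j reaches
  ... | w , w≢0 , pw≡0 = w , childOfRoot⇒IsRecord w≢0 pw≡0 , pw≡0

  blob-nonRecord : ∀ {i} → ¬ IsRecord T i → blob T i ≡ parent T i
  blob-nonRecord {i} ¬rec with isRecord? T i | nextRecord T i
  ... | yes rec | _ = ⊥-elim (¬rec rec)
  ... | no  _   | _ = refl

inner : ∀ {m} → Fin m → Fin (suc (suc m))
inner = fsuc ∘ inject₁

module _ {m : ℕ} (T : CayleyTree (suc m)) where

  nonRoot-∷ʳ : nonRoot T ≡ tabulate inner ∷ʳ fromℕ (suc m)
  nonRoot-∷ʳ = begin
    map fsuc (tabulate (λ i → i))  ≡⟨ map-tabulate (λ i → i) fsuc ⟩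
    tabulate fsuc                  ≡⟨ tabulate-∷ʳ m fsuc ⟩
    tabulate inner ∷ʳ fromℕ (suc m) ∎
    where open ≡-Reasoning

  -- The chain starts at tabulate fsuc because allFin (suc k) unfolds to fzero ∷ tabulate fsuc
  -- and the column test rejects fzero by computation.
  columns≡inner : columns T ≡ tabulate inner
  columns≡inner = begin
    filter isColumn? (tabulate fsuc)                             ≡⟨ cong (filter isColumn?) (tabulate-∷ʳ m fsuc) ⟩
    filter isColumn? (tabulate inner ++ [ top ])                 ≡⟨ filter-++ isColumn? (tabulate inner) [ top ] ⟩
    filter isColumn? (tabulate inner) ++ filter isColumn? [ top ] ≡⟨ cong₂ _++_ inner-kept top-dropped ⟩
    tabulate inner ++ []                                         ≡⟨ ++-identityʳ _ ⟩
    tabulate inner                                               ∎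
    where
    open ≡-Reasoning
    top : Fin (suc (suc m))
    top = fromℕ (suc m)
    isColumn? : ∀ i → Dec (1 ≤ toℕ i × toℕ i < suc m)
    isColumn? i = (1 ≤? toℕ i) ×-dec (toℕ i <? suc m)
    inner-isColumn : ∀ i → 1 ≤ toℕ (inner i) × toℕ (inner i) < suc m
    inner-isColumn i = s≤s z≤n , s≤s (subst (_< m) (sym (toℕ-inject₁ i)) (toℕ<n i))
    inner-kept : filter isColumn? (tabulate inner) ≡ tabulate inner
    inner-kept = filter-all isColumn? (tabulate⁺ inner-isColumn)
    top-dropped : filter isColumn? [ top ] ≡ []
    top-dropped = filter-none isColumn? ((λ (_ , top<n) → <-irrefl (toℕ-fromℕ (suc m)) top<n) ∷ [])

module OnlyRecordIsTop {m : ℕ} (T : CayleyTree (suc m))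
                       (onlyTop : ∀ k → IsRecord T k ⇔ (k ≡ fromℕ (suc m))) where

  top : Fin (suc (suc m))
  top = fromℕ (suc m)

  record⇒top : ∀ {k} → IsRecord T k → k ≡ top
  record⇒top = Equivalence.to (onlyTop _)

  inner≢top : ∀ i → inner i ≢ top
  inner≢top i = fromℕ≢inject₁ ∘ sym

  parent-top : parent T top ≡ fzero
  parent-top with ∃-childOfRoot-record T {top} (λ ())
  ... | w , w-rec , pw≡0 = subst (λ v → parent T v ≡ fzero) (record⇒top w-rec) pw≡0

  parent-inner≢root : ∀ i → parent T (inner i) ≢ fzero
  parent-inner≢root i p≡0 = inner≢top i (record⇒top (childOfRoot⇒IsRecord T (λ ()) p≡0))

  blob-inner : ∀ i → blob T (inner i) ≡ parent T (inner i)
  blob-inner i = blob-nonRecord T (inner≢top i ∘ record⇒top)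

  Edge : Set
  Edge = Fin (suc (suc m)) × Fin (suc (suc m))

  rootEdge : Edge
  rootEdge = edge fzero top

  innerEdges : List Edge
  innerEdges = tabulate (λ i → edge (inner i) (parent T (inner i)))

  treeEdges-∷ʳ : treeEdges T ≡ innerEdges ∷ʳ rootEdge
  treeEdges-∷ʳ = begin
    map treeEdge (nonRoot T)                      ≡⟨ cong (map treeEdge) (nonRoot-∷ʳ T) ⟩
    map treeEdge (tabulate inner ∷ʳ top)          ≡⟨ map-++ treeEdge (tabulate inner) [ top ] ⟩
    map treeEdge (tabulate inner) ∷ʳ treeEdge top ≡⟨ cong₂ _∷ʳ_ (map-tabulate inner treeEdge) (cong (edge top) parent-top) ⟩
    innerEdges ∷ʳ rootEdge                        ∎
    where
    open ≡-Reasoning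
    treeEdge : Fin (suc (suc m)) → Edge
    treeEdge k = edge k (parent T k)

  blobEdges≡innerEdges : blobEdges T ≡ innerEdges
  blobEdges≡innerEdges = begin
    map blobEdge (columns T)      ≡⟨ cong (map blobEdge) (columns≡inner T) ⟩
    map blobEdge (tabulate inner) ≡⟨ map-tabulate inner blobEdge ⟩
    tabulate (blobEdge ∘ inner)   ≡⟨ tabulate-cong (cong (edge (inner _)) ∘ blob-inner) ⟩
    innerEdges                    ∎
    where
    open ≡-Reasoning
    blobEdge : Fin (suc (suc m)) → Edge
    blobEdge i = edge i (blob T i)

  degree-root : degree T fzero ≡ 1
  degree-root = begin
    length (filter incident? (treeEdges T))                 ≡⟨ cong (length ∘ filter incident?) treeEdges-∷ʳ ⟩
    length (filter incident? (innerEdges ∷ʳ rootEdge))      ≡⟨ cong length (filter-++ incident? innerEdges [ rootEdge ]) ⟩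
    length (filter incident? innerEdges ++ [ rootEdge ])    ≡⟨ cong (λ es → length (es ++ [ rootEdge ])) innerEdges-avoid-root ⟩
    length ([] ++ [ rootEdge ])                             ∎
    where
    open ≡-Reasoning
    incident? : ∀ e → Dec (proj₁ e ≡ fzero ⊎ proj₂ e ≡ fzero)
    incident? e = (proj₁ e ≟ᶠ fzero) ⊎-dec (proj₂ e ≟ᶠ fzero)
    innerEdges-avoid-root : filter incident? innerEdges ≡ []
    innerEdges-avoid-root =
      filter-none incident? (tabulate⁺ (λ i → edge-avoids {a = inner i} (λ ()) (parent-inner≢root i)))

lemma2p3 : (n : ℕ) (T : CayleyTree n)
    → (∀ (k : Fin (suc n)) → IsRecord T k ⇔ (k ≡ fromℕ n))
    → (degree T fzero ≡ 1)
      × (edge fzero (fromℕ n) ∈ treeEdges T)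
      × (treeEdges T ↭ (edge fzero (fromℕ n) ∷ blobEdges T))
lemma2p3 zero    T onlyTop = ⊥-elim (proj₁ (Equivalence.from (onlyTop fzero) refl) refl)
lemma2p3 (suc m) T onlyTop = degree-root , rootEdge∈treeEdges , treeEdges↭
  where
  open OnlyRecordIsTop T onlyTop

  rootEdge∈treeEdges : rootEdge ∈ treeEdges T
  rootEdge∈treeEdges rewrite treeEdges-∷ʳ = ∈-++⁺ʳ innerEdges (here refl)

  treeEdges↭ : treeEdges T ↭ rootEdge ∷ blobEdges T
  treeEdges↭ rewrite treeEdges-∷ʳ | blobEdges≡innerEdges = ↭-sym (∷↭∷ʳ rootEdge innerEdges)
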